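{- Let $G$ be a graph on $n \geq 13$ vertices with $\delta(G) \geq \lfloor n/2 \rfloor + 1$, and let $A \subseteq V(G)$ satisfy $|A| = \lfloor n/2 \rfloor$. If $\langle A \rangle_3 = A$, then $m(G, 3) = 3$.
   Context: Graphs are finite and simple; $\delta(G)$ is the minimum degree and $N(v)$ the neighbourhood of $v$. For an integer $r \geq 2$, the $r$-neighbour bootstrap process on $G$ started from $A \subseteq V(G)$ is defined by $A_0 = A$ and $A_t = A_{t-1} \cup \{v \in V(G) : |N(v) \cap A_{t-1}| \geq r\}$ for $t \geq 1$. The closure is $\langle A \rangle_r = \bigcup_{t \geq 0} A_t$. The set $A$ percolates if $\langle A \rangle_r = V(G)$. Define $m(G,r) = \min\{|A| : A \subseteq V(G),\ \langle A \rangle_r = V(G)\}$. -}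

module Defs where

open import Data.Nat using (ℕ; zero; suc; _≤_)
open import Data.Bool using (Bool; true; false; if_then_else_)
open import Data.Fin using (Fin)
open import Data.Fin.Subset using (Subset; _∈_; _∩_; _∪_; ∣_∣)
open import Data.Vec using (tabulate)
open import Data.Product using (∃; _×_)
open import Relation.Binary.PropositionalEquality using (_≡_)
open import Relation.Nullary using (¬_)
open import Relation.Nullary.Decidable using (⌊_⌋)
open import Data.Nat using (_≤?_)

record Graph (n : ℕ) : Set where
  field
    adj   : Fin n → Fin n → Bool
    sym   : ∀ u v → adj u v ≡ adj v u
    irref : ∀ v → adj v v ≡ false
open Graph public

N : ∀ {n} → Graph n → Fin n → Subset n
N G v = tabulate (adj G v)

δ≥ : ∀ {n} → Graph n → ℕ → Set
δ≥ G d = ∀ v → d ≤ ∣ N G v ∣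

step : ∀ {n} → Graph n → ℕ → Subset n → Subset n
step G r A = A ∪ tabulate (λ v → ⌊ r ≤? ∣ N G v ∩ A ∣ ⌋)

iter : ∀ {n} → Graph n → ℕ → Subset n → ℕ → Subset n
iter G r A zero    = A
iter G r A (suc t) = step G r (iter G r A t)

_∈⟨_⟩[_,_] : ∀ {n} → Fin n → Subset n → Graph n → ℕ → Set
v ∈⟨ A ⟩[ G , r ] = ∃ λ t → v ∈ iter G r A t

-- ⟨A⟩_r = A  (the inclusion A ⊆ ⟨A⟩_r holds trivially with t = 0)
Closed : ∀ {n} → Graph n → ℕ → Subset n → Set
Closed G r A = ∀ v → v ∈⟨ A ⟩[ G , r ] → v ∈ A

Percolates : ∀ {n} → Graph n → ℕ → Subset n → Set
Percolates G r A = ∀ v → v ∈⟨ A ⟩[ G , r ]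

m≡ : ∀ {n} → Graph n → ℕ → ℕ → Set
m≡ G r k = (∃ λ A → ∣ A ∣ ≡ k × Percolates G r A)
         × (∀ A → Percolates G r A → k ≤ ∣ A ∣)

-- Write k = ⌊n/2⌋ and B for the complement of A, so |B| ≤ k + 1. Since A is closed, every
-- vertex of B has at most 2 neighbours in A; since δ ≥ k + 1 and |A| = k, every vertex of A
-- has at least 2 neighbours in B. Counting the A–B edges from both sides gives
-- 2k ≤ e(A, B) ≤ 2|B| ≤ 2k + 2, so the two bounds have a total slack of at most 2.
--
-- Take p ∈ A, a neighbour b ∈ B of p and two neighbours x, y ∈ A of p (the slack leaves p
-- at most 4 neighbours in B), and let C be the closure of {x, y, b}; then p ∈ C. A vertex of A outside C would have at least
-- |A ∩ C| ≥ 3 neighbours in B, and the surplus over 2 of all such vertices exceeds the slack;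
-- so A ∪ {b} ⊆ C. A vertex outside C has at least k − 1 neighbours outside C, so the
-- complement of C would be all of B − b; then every B-neighbour of b has at most one
-- neighbour in A, the slack bounds the B-degree of b by 2, and b would have degree at most
-- 4 < k + 1. Hence {x, y, b} percolates, while a set of fewer than 3 vertices is already
-- closed and so cannot percolate.

module Submission where

open import Defs
open import Data.Nat using (ℕ; _≤_; _+_)
open import Data.Nat.DivMod using (_/_)
open import Data.Fin.Subset using (Subset; ∣_∣)
open import Relation.Binary.PropositionalEquality using (_≡_)

open import Data.Nat.Properties hiding (_≟_)
open import Algebra.Properties.Semiring.Sum +-*-semiring
  using (sum; ∑-distrib-+; ∑-comm; sum-cong-≗; sum-replicate-zero; *-distribˡ-sum)
open import Data.Bool using (Bool; true; false; not; _∧_; _∨_; if_then_else_)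
open import Data.Bool.Properties using (∧-identityʳ; ∧-zeroʳ; ∧-assoc; ∨-zeroʳ; not-injective; ¬-not)
open import Data.Fin using (Fin; zero; suc)
open import Data.Fin.Properties using (_≟_; all?; ¬∀⟶∃¬)
open import Data.Fin.Subset using (_∈_; _⊆_; _∩_; ⊤)
open import Data.Fin.Subset.Properties
  using (_∈?_; p⊆p∪q; q⊆p∪q; x∈p∪q⁻; ⊆-antisym; p⊂q⇒∣p∣<∣q∣; ∣p∣≤n; ∣p∩q∣≤∣q∣; ∣⊤∣≡n; p⊆q⇒∣p∣≤∣q∣)
open import Data.Nat using (zero; suc; _*_; _∸_; _<_; z≤n; s≤s; s≤s⁻¹)
open import Data.Nat.DivMod using (_%_; m≡m%n+[m/n]*n; m%n<n; /-monoˡ-≤)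
open import Data.Product using (∃; ∃₂; _×_; _,_; proj₁; proj₂)
open import Data.Sum using (_⊎_; inj₁; inj₂; [_,_]′; map)
open import Data.Vec using ([]; _∷_; lookup; tabulate)
open import Data.Vec.Properties using (lookup-zipWith; lookup∘tabulate; []=⇒lookup; lookup⇒[]=)
open import Function using (_∘_; id)
open import Relation.Binary.PropositionalEquality
  using (_≢_; refl; trans; cong; cong₂; subst; subst₂; ≢-sym; module ≡-Reasoning) renaming (sym to ≡-sym)
open import Relation.Nullary using (¬_; Dec; does; yes; no; contradiction; _→-dec_)
open import Relation.Nullary.Decidable using (decidable-stable; dec-true; isYes≗does)

private
  variable
    n : ℕ
    P Q : Fin n → Bool
    x y z : Fin n

-- Vertex sets are handled as Boolean predicates Fin n → Bool and their sizes as sums of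
-- indicators; Subset n only appears at the interface with the bootstrap process.

𝟙 : Bool → ℕ
𝟙 true  = 1
𝟙 false = 0

∧-true⁻ : ∀ {a b} → a ∧ b ≡ true → a ≡ true × b ≡ true
∧-true⁻ {true} {true} _ = refl , refl

sum-mono-≤ : ∀ {n} {f g : Fin n → ℕ} → (∀ i → f i ≤ g i) → sum f ≤ sum g
sum-mono-≤ {zero}  _   = z≤n
sum-mono-≤ {suc n} f≤g = +-mono-≤ (f≤g zero) (sum-mono-≤ (f≤g ∘ suc))

sum-mono-< : ∀ {n} {f g : Fin n → ℕ} → (∀ i → f i ≤ g i) → ∀ i → f i < g i → sum f < sum g
sum-mono-< f≤g zero    fi<gi = +-mono-<-≤ fi<gi (sum-mono-≤ (f≤g ∘ suc))
sum-mono-< f≤g (suc i) fi<gi = +-mono-≤-< (f≤g zero) (sum-mono-< (f≤g ∘ suc) i fi<gi)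

term≤sum : ∀ {n} (f : Fin n → ℕ) i → f i ≤ sum f
term≤sum f zero    = m≤m+n (f zero) _
term≤sum f (suc i) = ≤-trans (term≤sum (f ∘ suc) i) (m≤n+m _ (f zero))

infixr 7 _∩ᵇ_
infixl 6 _-ᵇ_
infix  4 _⊆ᵇ_

_∩ᵇ_ : (Fin n → Bool) → (Fin n → Bool) → Fin n → Bool
(P ∩ᵇ Q) i = P i ∧ Q i

∁ᵇ : (Fin n → Bool) → Fin n → Bool
∁ᵇ P i = not (P i)

_-ᵇ_ : (Fin n → Bool) → Fin n → Fin n → Bool
(P -ᵇ x) i = P i ∧ not (does (i ≟ x))

_⊆ᵇ_ : (Fin n → Bool) → (Fin n → Bool) → Set
P ⊆ᵇ Q = ∀ i → P i ≡ true → Q i ≡ true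

-ᵇ-intro : P y ≡ true → y ≢ x → (P -ᵇ x) y ≡ true
-ᵇ-intro {y = y} {x = x} Py y≢x with y ≟ x
... | yes y≡x = contradiction y≡x y≢x
... | no  _   = cong (_∧ true) Py

-ᵇ-elim : (P -ᵇ x) y ≡ true → P y ≡ true × y ≢ x
-ᵇ-elim {P = P} {x = x} {y = y} h with y ≟ x
... | yes _   = contradiction (proj₂ (∧-true⁻ {P y} h)) λ ()
... | no y≢x = proj₁ (∧-true⁻ {P y} h) , y≢x

≢-by : ∀ {n} (P : Fin n → Bool) {x y} → P x ≡ true → P y ≡ false → x ≢ y
≢-by P Px Py refl = contradiction (trans (≡-sym Px) Py) λ ()

count : (Fin n → Bool) → ℕ
count P = sum (𝟙 ∘ P)

count-∅ : ∀ {n} {P : Fin n → Bool} → (∀ i → P i ≡ false) → count P ≡ 0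
count-∅ {n} none = trans (sum-cong-≗ (cong 𝟙 ∘ none)) (sum-replicate-zero n)

count-⊤ : count {n} (λ _ → true) ≡ n
count-⊤ {zero}  = refl
count-⊤ {suc n} = cong suc (count-⊤ {n})

𝟙-mono : ∀ {a b} → (a ≡ true → b ≡ true) → 𝟙 a ≤ 𝟙 b
𝟙-mono {false} _   = z≤n
𝟙-mono {true}  a⇒b rewrite a⇒b refl = ≤-refl

∩ᵇ-monoʳ : ∀ {n} (P : Fin n → Bool) {Q R} → Q ⊆ᵇ R → P ∩ᵇ Q ⊆ᵇ P ∩ᵇ R
∩ᵇ-monoʳ P Q⊆R i h = let Pi , Qi = ∧-true⁻ {P i} h in cong₂ _∧_ Pi (Q⊆R i Qi)

count-mono : P ⊆ᵇ Q → count P ≤ count Q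
count-mono P⊆Q = sum-mono-≤ λ i → 𝟙-mono (P⊆Q i)

count-mono-< : P ⊆ᵇ Q → P x ≡ false → Q x ≡ true → count P < count Q
count-mono-< {x = x} P⊆Q Px Qx = sum-mono-< (λ i → 𝟙-mono (P⊆Q i)) x (subst₂ (λ a b → 𝟙 a < 𝟙 b) (≡-sym Px) (≡-sym Qx) ≤-refl)

count-split : ∀ {n} (P Q : Fin n → Bool) → count P ≡ count (P ∩ᵇ Q) + count (P ∩ᵇ ∁ᵇ Q)
count-split P Q = trans (sum-cong-≗ λ i → 𝟙-split (P i) (Q i)) (∑-distrib-+ (𝟙 ∘ (P ∩ᵇ Q)) (𝟙 ∘ (P ∩ᵇ ∁ᵇ Q)))
  where
  𝟙-split : ∀ a b → 𝟙 a ≡ 𝟙 (a ∧ b) + 𝟙 (a ∧ not b)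
  𝟙-split true  true  = refl
  𝟙-split true  false = refl
  𝟙-split false _     = refl

count+count∁ : ∀ {n} (P : Fin n → Bool) → count P + count (∁ᵇ P) ≡ n
count+count∁ P = trans (≡-sym (count-split (λ _ → true) P)) count-⊤

count-remove : ∀ {n} (P : Fin n → Bool) {x} → P x ≡ true → count P ≡ suc (count (P -ᵇ x))
count-remove P {zero} Px rewrite Px =
  cong suc (sum-cong-≗ λ i → cong 𝟙 (≡-sym (∧-identityʳ (P (suc i)))))
count-remove P {suc x} Px = begin
  𝟙 (P zero) + count (P ∘ suc)                   ≡⟨ cong (𝟙 (P zero) +_) (count-remove (P ∘ suc) Px) ⟩
  𝟙 (P zero) + suc (count (P ∘ suc -ᵇ x))        ≡⟨ +-suc _ _ ⟩
  suc (𝟙 (P zero) + count (P ∘ suc -ᵇ x))        ≡⟨ cong (λ a → suc (𝟙 a + count (P ∘ suc -ᵇ x))) (≡-sym (∧-identityʳ (P zero))) ⟩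
  suc (𝟙 (P zero ∧ true) + count (P ∘ suc -ᵇ x)) ∎
  where open ≡-Reasoning

member⇒1≤count : P x ≡ true → 1 ≤ count P
member⇒1≤count {P = P} Px = subst (1 ≤_) (≡-sym (count-remove P Px)) (s≤s z≤n)

1≤count⇒member : ∀ {n} {P : Fin n → Bool} → 1 ≤ count P → ∃ λ x → P x ≡ true
1≤count⇒member {suc n} {P} h with P zero in P0
... | true  = zero , P0
... | false = let x , Px = 1≤count⇒member {P = P ∘ suc} h in suc x , Px

2≤count⇒pair : 2 ≤ count P → ∃₂ λ x y → x ≢ y × P x ≡ true × P y ≡ true
2≤count⇒pair {P = P} 2≤ with 1≤count⇒member (≤-trans (s≤s z≤n) 2≤)
... | x , Px with 1≤count⇒member {P = P -ᵇ x} (s≤s⁻¹ (subst (2 ≤_) (count-remove P Px) 2≤))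
... | y , [P-x]y = let Py , y≢x = -ᵇ-elim {P = P} [P-x]y in x , y , ≢-sym y≢x , Px , Py

count-⊆-≤⇒⊇ : P ⊆ᵇ Q → count Q ≤ count P → Q ⊆ᵇ P
count-⊆-≤⇒⊇ {P = P} P⊆Q Q≤P i Qi with P i in Pi
... | true  = refl
... | false = contradiction Q≤P (<⇒≱ (count-mono-< P⊆Q Pi Qi))

sum-if : ∀ {n} (P : Fin n → Bool) c → sum (λ i → if P i then c else 0) ≡ count P * c
sum-if {zero}  P c = refl
sum-if {suc n} P c with P zero
... | true  = cong (c +_) (sum-if (P ∘ suc) c)
... | false = sum-if (P ∘ suc) c

⁅_,_,_⁆ᵇ : Fin n → Fin n → Fin n → Fin n → Bool
⁅ x , y , z ⁆ᵇ i = does (i ≟ x) ∨ does (i ≟ y) ∨ does (i ≟ z)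

x∈⁅x,y,z⁆ᵇ : ∀ {n} (x y z : Fin n) → ⁅ x , y , z ⁆ᵇ x ≡ true
x∈⁅x,y,z⁆ᵇ x _ _ rewrite dec-true (x ≟ x) refl = refl

y∈⁅x,y,z⁆ᵇ : ∀ {n} (x y z : Fin n) → ⁅ x , y , z ⁆ᵇ y ≡ true
y∈⁅x,y,z⁆ᵇ _ y _ rewrite dec-true (y ≟ y) refl = ∨-zeroʳ _

z∈⁅x,y,z⁆ᵇ : ∀ {n} (x y z : Fin n) → ⁅ x , y , z ⁆ᵇ z ≡ true
z∈⁅x,y,z⁆ᵇ x _ z rewrite dec-true (z ≟ z) refl =
  trans (cong (does (z ≟ x) ∨_) (∨-zeroʳ _)) (∨-zeroʳ _)

count-⁅x,y,z⁆ᵇ : x ≢ y → x ≢ z → y ≢ z → count ⁅ x , y , z ⁆ᵇ ≡ 3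
count-⁅x,y,z⁆ᵇ {x = x} {y = y} {z = z} x≢y x≢z y≢z = begin
  count T                                 ≡⟨ count-remove T (x∈⁅x,y,z⁆ᵇ x y z) ⟩
  suc (count (T -ᵇ x))                    ≡⟨ cong suc (count-remove (T -ᵇ x) [T-x]y) ⟩
  suc (suc (count (T -ᵇ x -ᵇ y)))         ≡⟨ cong (2 +_) (count-remove (T -ᵇ x -ᵇ y) [T-x-y]z) ⟩
  3 + count (T -ᵇ x -ᵇ y -ᵇ z)             ≡⟨ cong (3 +_) (count-∅ λ i → nothing-left (does (i ≟ x)) (does (i ≟ y)) (does (i ≟ z))) ⟩
  3                                       ∎
  where
  open ≡-Reasoning
  T : Fin _ → Bool
  T = ⁅ x , y , z ⁆ᵇ
  [T-x]y : (T -ᵇ x) y ≡ true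
  [T-x]y = -ᵇ-intro {P = T} (y∈⁅x,y,z⁆ᵇ x y z) (≢-sym x≢y)
  [T-x-y]z : (T -ᵇ x -ᵇ y) z ≡ true
  [T-x-y]z = -ᵇ-intro {P = T -ᵇ x} (-ᵇ-intro {P = T} (z∈⁅x,y,z⁆ᵇ x y z) (≢-sym x≢z)) (≢-sym y≢z)
  nothing-left : ∀ a b c → (((a ∨ b ∨ c) ∧ not a) ∧ not b) ∧ not c ≡ false
  nothing-left true  _     _     = refl
  nothing-left false true  _     = refl
  nothing-left false false true  = refl
  nothing-left false false false = refl

⁅x,y,z⁆ᵇ⊆ : P x ≡ true → P y ≡ true → P z ≡ true → ⁅ x , y , z ⁆ᵇ ⊆ᵇ P
⁅x,y,z⁆ᵇ⊆ {x = x} {y = y} {z = z} Px Py Pz i i∈ with i ≟ x | i ≟ y | i ≟ z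
... | yes refl | _        | _        = Px
... | no _     | yes refl | _        = Py
... | no _     | no _     | yes refl = Pz
... | no _     | no _     | no _     = contradiction i∈ λ ()

triple⇒3≤count : x ≢ y → x ≢ z → y ≢ z → P x ≡ true → P y ≡ true → P z ≡ true → 3 ≤ count P
triple⇒3≤count {P = P} x≢y x≢z y≢z Px Py Pz =
  subst (_≤ count P) (count-⁅x,y,z⁆ᵇ x≢y x≢z y≢z) (count-mono (⁅x,y,z⁆ᵇ⊆ {P = P} Px Py Pz))

-- Degrees and edge counts

deg : Graph n → (Fin n → Bool) → Fin n → ℕ
deg G X v = count (adj G v ∩ᵇ X)

degree-split : ∀ {n} (G : Graph n) X v → count (adj G v) ≡ deg G X v + deg G (∁ᵇ X) v
degree-split G X v = count-split (adj G v) X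

deg-split : ∀ {n} (G : Graph n) X Y v → deg G X v ≡ deg G (X ∩ᵇ Y) v + deg G (X ∩ᵇ ∁ᵇ Y) v
deg-split G X Y v = trans (count-split (adj G v ∩ᵇ X) Y) (cong₂ _+_ (reassoc Y) (reassoc (∁ᵇ Y)))
  where
  reassoc : ∀ Z → count ((adj G v ∩ᵇ X) ∩ᵇ Z) ≡ count (adj G v ∩ᵇ (X ∩ᵇ Z))
  reassoc Z = sum-cong-≗ λ j → cong 𝟙 (∧-assoc (adj G v j) (X j) (Z j))

deg-mono : ∀ {n} (G : Graph n) {X Y} v → X ⊆ᵇ Y → deg G X v ≤ deg G Y v
deg-mono G v X⊆Y = count-mono (∩ᵇ-monoʳ (adj G v) X⊆Y)

adj⇒≢ : ∀ {n} (G : Graph n) {u w} → adj G u w ≡ true → u ≢ w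
adj⇒≢ G {u} uw = ≢-sym (≢-by (adj G u) uw (irref G u))

deg-< : ∀ {n} (G : Graph n) {X v} → X v ≡ true → deg G X v < count X
deg-< G {X} {v} Xv = count-mono-< (λ j h → proj₂ (∧-true⁻ {adj G v j} h)) (cong (_∧ X v) (irref G v)) Xv

deg+𝟙adj≤deg : ∀ {n} (G : Graph n) {X Y w} v → X ⊆ᵇ Y → X w ≡ false → Y w ≡ true →
               deg G X v + 𝟙 (adj G v w) ≤ deg G Y v
deg+𝟙adj≤deg G {X} {Y} {w} v X⊆Y Xw Yw with adj G v w in vw
... | true  = subst (_≤ deg G Y v) (+-comm 1 (deg G X v)) (count-mono-< (∩ᵇ-monoʳ (adj G v) X⊆Y) (cong₂ _∧_ vw Xw) (cong₂ _∧_ vw Yw))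
... | false = subst (_≤ _) (≡-sym (+-identityʳ _)) (deg-mono G v X⊆Y)

edges : Graph n → (Fin n → Bool) → (Fin n → Bool) → ℕ
edges G X Y = sum λ u → count λ v → X u ∧ (adj G u v ∧ Y v)

edges-comm : ∀ {n} (G : Graph n) X Y → edges G X Y ≡ edges G Y X
edges-comm G X Y = trans (∑-comm (λ u v → 𝟙 (X u ∧ (adj G u v ∧ Y v))))
  (sum-cong-≗ λ v → sum-cong-≗ λ u → cong 𝟙 (swap (X u) (Y v) (sym G u v)))
  where
  swap : ∀ a d {b c} → b ≡ c → a ∧ (b ∧ d) ≡ d ∧ (c ∧ a)
  swap true  true  refl = refl
  swap true  false {b} refl = ∧-zeroʳ b
  swap false true  {b} refl = ≡-sym (∧-zeroʳ b)
  swap false false refl = refl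

edges-≥ : ∀ {n} (G : Graph n) {X Y} {f : Fin n → ℕ} →
          (∀ u → X u ≡ true → f u ≤ deg G Y u) → (∀ u → X u ≡ false → f u ≡ 0) → sum f ≤ edges G X Y
edges-≥ G {X} {Y} {f} on off = sum-mono-≤ pointwise
  where
  pointwise : ∀ u → f u ≤ count λ v → X u ∧ (adj G u v ∧ Y v)
  pointwise u with X u in Xu
  ... | true  = on u Xu
  ... | false = ≤-reflexive (trans (off u Xu) (≡-sym (count-∅ {P = λ v → false ∧ (adj G u v ∧ Y v)} λ _ → refl)))

edges+sum≤ : ∀ {n} (G : Graph n) {X Y} {f g : Fin n → ℕ} →
             (∀ u → X u ≡ true → deg G Y u + g u ≤ f u) → (∀ u → X u ≡ false → g u ≡ 0) →
             edges G X Y + sum g ≤ sum f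
edges+sum≤ G {X} {Y} {f} {g} on off = begin
  edges G X Y + sum g                               ≡⟨ ∑-distrib-+ row g ⟨
  sum (λ u → row u + g u)                           ≤⟨ sum-mono-≤ pointwise ⟩
  sum f                                             ∎
  where
  open ≤-Reasoning
  row : Fin _ → ℕ
  row u = count λ v → X u ∧ (adj G u v ∧ Y v)
  pointwise : ∀ u → row u + g u ≤ f u
  pointwise u with X u in Xu
  ... | true  = on u Xu
  ... | false = subst (_≤ f u) (≡-sym (cong₂ _+_ (count-∅ {P = λ v → false ∧ (adj G u v ∧ Y v)} λ _ → refl) (off u Xu))) z≤n

-- The bootstrap process

Stableᵇ : Graph n → ℕ → (Fin n → Bool) → Set
Stableᵇ G r X = ∀ v → X v ≡ false → deg G X v < r

∣p∣≡count : ∀ {n} (p : Subset n) → ∣ p ∣ ≡ count (lookup p)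
∣p∣≡count []          = refl
∣p∣≡count (true  ∷ p) = cong suc (∣p∣≡count p)
∣p∣≡count (false ∷ p) = ∣p∣≡count p

∣N∣≡degree : ∀ {n} (G : Graph n) v → ∣ N G v ∣ ≡ count (adj G v)
∣N∣≡degree G v = trans (∣p∣≡count (N G v)) (sum-cong-≗ λ j → cong 𝟙 (lookup∘tabulate (adj G v) j))

∣N∩X∣≡deg : ∀ {n} (G : Graph n) X v → ∣ N G v ∩ X ∣ ≡ deg G (lookup X) v
∣N∩X∣≡deg G X v = trans (∣p∣≡count (N G v ∩ X)) (sum-cong-≗ λ j → cong 𝟙
  (trans (lookup-zipWith _∧_ j (N G v) X) (cong (_∧ lookup X j) (lookup∘tabulate (adj G v) j))))

Stable : Graph n → ℕ → Subset n → Set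
Stable G r X = ∀ v → r ≤ ∣ N G v ∩ X ∣ → v ∈ X

Stable⇒Stableᵇ : ∀ {n} {G : Graph n} {r X} → Stable G r X → Stableᵇ G r (lookup X)
Stable⇒Stableᵇ {G = G} {r} {X} stable v Xv = ≰⇒> λ r≤deg →
  contradiction (trans (≡-sym Xv) ([]=⇒lookup (stable v (subst (r ≤_) (≡-sym (∣N∩X∣≡deg G X v)) r≤deg)))) λ ()

∈-step⁺ : ∀ {n} (G : Graph n) r X v → r ≤ ∣ N G v ∩ X ∣ → v ∈ step G r X
∈-step⁺ G r X v r≤ = q⊆p∪q X _ (lookup⇒[]= v _
  (trans (lookup∘tabulate _ v) (trans (isYes≗does (r ≤? _)) (dec-true (r ≤? _) r≤))))

∈-step⁻ : ∀ {n} (G : Graph n) r X v → v ∈ step G r X → v ∈ X ⊎ r ≤ ∣ N G v ∩ X ∣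
∈-step⁻ G r X v v∈ = map id (λ v∈new → does⇒ (r ≤? _)
  (trans (≡-sym (isYes≗does (r ≤? _))) (trans (≡-sym (lookup∘tabulate _ v)) ([]=⇒lookup v∈new)))) (x∈p∪q⁻ X _ v∈)
  where
  does⇒ : ∀ {A : Set} (a? : Dec A) → does a? ≡ true → A
  does⇒ (yes a) _ = a

closed⇒stable : ∀ {n} {G : Graph n} {r A} → Closed G r A → Stable G r A
closed⇒stable {G = G} {r} {A} closed v r≤ = closed v (1 , ∈-step⁺ G r A v r≤)

iter-stable : ∀ {n} {G : Graph n} {r X} → Stable G r X → ∀ t → iter G r X t ≡ X
iter-stable _ zero = refl
iter-stable {G = G} {r} {X} stable (suc t) = trans (cong (step G r) (iter-stable stable t)) step≡
  where
  step≡ : step G r X ≡ X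
  step≡ = ⊆-antisym (λ {v} v∈ → [ id , stable v ]′ (∈-step⁻ G r X v v∈)) (p⊆p∪q _)

⊆-iter : ∀ {n} (G : Graph n) r A t → A ⊆ iter G r A t
⊆-iter G r A zero    = id
⊆-iter G r A (suc t) = p⊆p∪q _ ∘ ⊆-iter G r A t

stable? : ∀ {n} (G : Graph n) r X → Dec (Stable G r X)
stable? G r X = all? λ v → (r ≤? ∣ N G v ∩ X ∣) →-dec (v ∈? X)

step-grows : ∀ {n} {G : Graph n} {r X} → ¬ Stable G r X → ∣ X ∣ < ∣ step G r X ∣
step-grows {G = G} {r} {X} unstable with ¬∀⟶∃¬ _ _ (λ v → (r ≤? ∣ N G v ∩ X ∣) →-dec (v ∈? X)) unstable
... | v , ¬[r≤⇒v∈X] = p⊂q⇒∣p∣<∣q∣ (p⊆p∪q _ , v , ∈-step⁺ G r X v r≤ , λ v∈X → ¬[r≤⇒v∈X] λ _ → v∈X)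
  where
  r≤ : r ≤ ∣ N G v ∩ X ∣
  r≤ = decidable-stable (r ≤? _) λ r≰ → ¬[r≤⇒v∈X] λ r≤ → contradiction r≤ r≰

iter-stabilises : ∀ {n} (G : Graph n) r A → ∃ λ t → Stable G r (iter G r A t)
iter-stabilises {n} G r A = [ id , (λ n<∣Aₜ∣ → contradiction (∣p∣≤n (iter G r A (suc n))) (<⇒≱ n<∣Aₜ∣)) ]′ (progress (suc n))
  where
  progress : ∀ t → (∃ λ s → Stable G r (iter G r A s)) ⊎ t ≤ ∣ iter G r A t ∣
  progress zero = inj₂ z≤n
  progress (suc t) with progress t
  ... | inj₁ found = inj₁ found
  ... | inj₂ t≤∣Aₜ∣ with stable? G r (iter G r A t)
  ...   | yes stable   = inj₁ (t , stable)
  ...   | no  unstable = inj₂ (≤-<-trans t≤∣Aₜ∣ (step-grows {G = G} unstable))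

percolating⇒r≤∣A∣ : ∀ {n} {G : Graph n} {r A} → r ≤ n → Percolates G r A → r ≤ ∣ A ∣
percolating⇒r≤∣A∣ {n} {G} {r} {A} r≤n percolates = decidable-stable (r ≤? ∣ A ∣) λ r≰∣A∣ →
  r≰∣A∣ (≤-trans r≤n (subst (_≤ ∣ A ∣) (∣⊤∣≡n n) (p⊆q⇒∣p∣≤∣q∣ (⊤⊆A (≰⇒> r≰∣A∣)))))
  where
  ⊤⊆A : ∣ A ∣ < r → ⊤ ⊆ A
  ⊤⊆A small {v} _ = let t , v∈Aₜ = percolates v in
    subst (v ∈_) (iter-stable (λ w r≤ → contradiction (≤-trans r≤ (∣p∩q∣≤∣q∣ (N G w) A)) (<⇒≱ small)) t) v∈Aₜ

-- A closed set of size k in a graph of minimum degree k + 1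

3≤u*[t∸2] : ∀ {t u} → 3 ≤ t → 1 ≤ u → 6 ≤ t + u → 3 ≤ u * (t ∸ 2)
3≤u*[t∸2] {suc (suc (suc r))} {suc w} (s≤s (s≤s (s≤s _))) (s≤s _) (s≤s (s≤s (s≤s 3≤r+1+w))) = begin
  3                    ≤⟨ s≤s (s≤s⁻¹ (subst (3 ≤_) (+-suc r w) 3≤r+1+w)) ⟩
  suc (r + w)          ≤⟨ s≤s (+-monoʳ-≤ r (m≤m*n w (suc r))) ⟩
  suc (r + w * suc r)  ∎
  where open ≤-Reasoning

module ClosedHalf {n} (G : Graph n) (A : Fin n → Bool) (k : ℕ) (6≤k : 6 ≤ k)
  (δ : ∀ v → suc k ≤ count (adj G v)) (∣A∣≡k : count A ≡ k) (∣∁A∣≤k+1 : count (∁ᵇ A) ≤ suc k)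
  (A-stable : Stableᵇ G 3 A) where

  B : Fin n → Bool
  B = ∁ᵇ A

  suc-k≤degA+degB : ∀ v → suc k ≤ deg G A v + deg G B v
  suc-k≤degA+degB v = subst (suc k ≤_) (degree-split G A v) (δ v)

  2≤deg-B : ∀ {v} → A v ≡ true → 2 ≤ deg G B v
  2≤deg-B {v} Av = +-cancelˡ-≤ (deg G A v) 2 (deg G B v) (≤-trans degA+2≤suc-k (suc-k≤degA+degB v))
    where
    degA+2≤suc-k : deg G A v + 2 ≤ suc k
    degA+2≤suc-k = subst (_≤ suc k) (+-comm 2 _) (s≤s (subst (deg G A v <_) ∣A∣≡k (deg-< G Av)))

  E : ℕ
  E = edges G A B

  E-lower : ∀ g → (∀ u → A u ≡ true → 2 + g u ≤ deg G B u) → (∀ u → A u ≡ false → g u ≡ 0) →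
            2 * k + sum g ≤ E
  E-lower g on off = begin
    2 * k + sum g                   ≡⟨ cong (_+ sum g) (trans (cong (2 *_) (≡-sym ∣A∣≡k)) (*-distribˡ-sum 2 (𝟙 ∘ A))) ⟩
    sum (λ u → 2 * 𝟙 (A u)) + sum g ≡⟨ ∑-distrib-+ (λ u → 2 * 𝟙 (A u)) g ⟨
    sum (λ u → 2 * 𝟙 (A u) + g u)   ≤⟨ edges-≥ G on′ off′ ⟩
    E                               ∎
    where
    open ≤-Reasoning
    on′ : ∀ u → A u ≡ true → 2 * 𝟙 (A u) + g u ≤ deg G B u
    on′ u Au = subst (λ a → 2 * 𝟙 a + g u ≤ deg G B u) (≡-sym Au) (on u Au)
    off′ : ∀ u → A u ≡ false → 2 * 𝟙 (A u) + g u ≡ 0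
    off′ u Au = subst (λ a → 2 * 𝟙 a + g u ≡ 0) (≡-sym Au) (off u Au)

  E-upper : ∀ h → (∀ u → A u ≡ false → deg G A u + h u ≤ 2) → (∀ u → A u ≡ true → h u ≡ 0) →
            E + sum h ≤ 2 * k + 2
  E-upper h on off = begin
    E + sum h                 ≡⟨ cong (_+ sum h) (edges-comm G A B) ⟩
    edges G B A + sum h       ≤⟨ edges+sum≤ G on′ (λ u Bu → off u (not-injective Bu)) ⟩
    sum (λ u → 2 * 𝟙 (B u))   ≡⟨ *-distribˡ-sum 2 (𝟙 ∘ B) ⟨
    2 * count B               ≤⟨ *-monoʳ-≤ 2 ∣∁A∣≤k+1 ⟩
    2 * suc k                 ≡⟨ trans (*-suc 2 k) (+-comm 2 (2 * k)) ⟩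
    2 * k + 2                 ∎
    where
    open ≤-Reasoning
    on′ : ∀ u → B u ≡ true → deg G A u + h u ≤ 2 * 𝟙 (B u)
    on′ u Bu = subst (λ a → deg G A u + h u ≤ 2 * 𝟙 a) (≡-sym Bu) (on u (not-injective Bu))

  excess≤2 : ∀ g → (∀ u → A u ≡ true → 2 + g u ≤ deg G B u) → (∀ u → A u ≡ false → g u ≡ 0) → sum g ≤ 2
  excess≤2 g on off = +-cancelˡ-≤ (2 * k) (sum g) 2
    (≤-trans (E-lower g on off) (≤-trans (m≤m+n E _) (E-upper (λ _ → 0) A-tight (λ _ _ → refl))))
    where
    A-tight : ∀ u → A u ≡ false → deg G A u + 0 ≤ 2
    A-tight u Au = subst (_≤ 2) (≡-sym (+-identityʳ _)) (s≤s⁻¹ (A-stable u Au))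

  slack≤2 : ∀ h → (∀ u → A u ≡ false → deg G A u + h u ≤ 2) → (∀ u → A u ≡ true → h u ≡ 0) → sum h ≤ 2
  slack≤2 h on off = +-cancelˡ-≤ (2 * k) (sum h) 2
    (≤-trans (+-monoˡ-≤ (sum h) 2k≤E) (E-upper h on off))
    where
    2k≤E : 2 * k ≤ E
    2k≤E = ≤-trans (m≤m+n (2 * k) _) (E-lower (λ _ → 0) (λ _ Au → 2≤deg-B Au) (λ _ _ → refl))

  deg-B≤4 : ∀ {p} → A p ≡ true → deg G B p ≤ 4
  deg-B≤4 {p} Ap = begin
    deg G B p            ≡⟨ m+[n∸m]≡n (2≤deg-B Ap) ⟨
    2 + (deg G B p ∸ 2)  ≤⟨ +-monoʳ-≤ 2 (≤-trans (≤-reflexive (cong (surplus-if p) (≡-sym Ap))) surplus-p≤2) ⟩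
    4                    ∎
    where
    open ≤-Reasoning
    surplus-if : Fin n → Bool → ℕ
    surplus-if u a = if a then deg G B u ∸ 2 else 0
    surplus : Fin n → ℕ
    surplus u = surplus-if u (A u)
    surplus-p≤2 : surplus p ≤ 2
    surplus-p≤2 = ≤-trans (term≤sum surplus p) (excess≤2 surplus
      (λ u Au → subst (λ a → 2 + surplus-if u a ≤ deg G B u) (≡-sym Au) (≤-reflexive (m+[n∸m]≡n (2≤deg-B Au))))
      (λ u Au → cong (surplus-if u) Au))

  2≤deg-A : ∀ {p} → A p ≡ true → 2 ≤ deg G A p
  2≤deg-A {p} Ap = +-cancelʳ-≤ 4 2 (deg G A p)
    (≤-trans 6≤k (≤-trans (n≤1+n k) (≤-trans (suc-k≤degA+degB p) (+-monoʳ-≤ _ (deg-B≤4 Ap)))))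

  module Closure (C : Fin n → Bool) (C-stable : Stableᵇ G 3 C)
    {p b x y : Fin n} (Ap : A p ≡ true) (Ab : A b ≡ false) (Ax : A x ≡ true) (Ay : A y ≡ true)
    (p~b : adj G p b ≡ true) (p~x : adj G p x ≡ true) (p~y : adj G p y ≡ true) (x≢y : x ≢ y)
    (Cx : C x ≡ true) (Cy : C y ≡ true) (Cb : C b ≡ true) where

    degC≤2 : ∀ {v} → C v ≡ false → deg G C v ≤ 2
    degC≤2 Cv = s≤s⁻¹ (C-stable _ Cv)

    Cp : C p ≡ true
    Cp = ¬-not λ Cp≡false → contradiction
      (triple⇒3≤count {P = adj G p ∩ᵇ C} x≢y (≢-by A Ax Ab) (≢-by A Ay Ab)
        (cong₂ _∧_ p~x Cx) (cong₂ _∧_ p~y Cy) (cong₂ _∧_ p~b Cb))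
      (<⇒≱ (C-stable p Cp≡false))

    inside outside : ℕ
    inside  = count (A ∩ᵇ C)
    outside = count (A ∩ᵇ ∁ᵇ C)

    k≡inside+outside : k ≡ inside + outside
    k≡inside+outside = trans (≡-sym ∣A∣≡k) (count-split A C)

    3≤inside : 3 ≤ inside
    3≤inside = triple⇒3≤count {P = A ∩ᵇ C} x≢y (≢-sym (adj⇒≢ G p~x)) (≢-sym (adj⇒≢ G p~y))
      (cong₂ _∧_ Ax Cx) (cong₂ _∧_ Ay Cy) (cong₂ _∧_ Ap Cp)

    inside≤deg-B : ∀ {j} → A j ≡ true → C j ≡ false → inside ≤ deg G B j
    inside≤deg-B {j} Aj Cj = +-cancelˡ-≤ (deg G A j) inside (deg G B j)
      (≤-trans (s≤s⁻¹ degA+inside<suc-suc-k) (suc-k≤degA+degB j))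
      where
      open ≤-Reasoning
      degA+inside<suc-suc-k : suc (deg G A j + inside) ≤ suc (suc k)
      degA+inside<suc-suc-k = begin
        suc (deg G A j + inside)                                    ≡⟨ cong (λ d → suc (d + inside)) (deg-split G A C j) ⟩
        suc (deg G (A ∩ᵇ C) j + deg G (A ∩ᵇ ∁ᵇ C) j + inside)        ≡⟨ cong (_+ inside) (+-suc _ _) ⟨
        deg G (A ∩ᵇ C) j + suc (deg G (A ∩ᵇ ∁ᵇ C) j) + inside        ≤⟨ +-monoˡ-≤ inside (+-mono-≤
                                                                         (≤-trans (deg-mono G j (λ i h → proj₂ (∧-true⁻ {A i} h))) (degC≤2 Cj))
                                                                         (deg-< G (cong₂ _∧_ Aj (cong not Cj)))) ⟩
        2 + outside + inside                                        ≡⟨ cong (2 +_) (trans (+-comm outside inside) (≡-sym k≡inside+outside)) ⟩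
        suc (suc k)                                                 ∎

    A⊆C : A ⊆ᵇ C
    A⊆C i Ai = ¬-not λ Ci≡false → contradiction (excess≤2 surplus on off) (<⇒≱ (2<sum-surplus Ci≡false))
      where
      surplus-if : Bool → ℕ
      surplus-if a = if a then inside ∸ 2 else 0
      surplus : Fin n → ℕ
      surplus j = surplus-if ((A ∩ᵇ ∁ᵇ C) j)
      on : ∀ j → A j ≡ true → 2 + surplus j ≤ deg G B j
      on j Aj with C j in Cj
      ... | true  = subst (λ a → 2 + surplus-if (a ∧ false) ≤ deg G B j) (≡-sym Aj) (2≤deg-B Aj)
      ... | false = subst (λ a → 2 + surplus-if (a ∧ true) ≤ deg G B j) (≡-sym Aj)
                      (subst (_≤ deg G B j) (≡-sym (m+[n∸m]≡n (≤-trans (n≤1+n 2) 3≤inside))) (inside≤deg-B Aj Cj))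
      off : ∀ j → A j ≡ false → surplus j ≡ 0
      off j Aj = cong (λ a → surplus-if (a ∧ not (C j))) Aj
      2<sum-surplus : C i ≡ false → 2 < sum surplus
      2<sum-surplus Ci = subst (2 <_) (≡-sym (sum-if (A ∩ᵇ ∁ᵇ C) (inside ∸ 2)))
        (3≤u*[t∸2] 3≤inside (member⇒1≤count {P = A ∩ᵇ ∁ᵇ C} (cong₂ _∧_ Ai (cong not Ci)))
          (subst (6 ≤_) k≡inside+outside 6≤k))

    ∁C⊆B-b : ∁ᵇ C ⊆ᵇ B -ᵇ b
    ∁C⊆B-b j ¬Cj = -ᵇ-intro {P = B} (cong not Aj) (≢-sym (≢-by C Cb Cj))
      where
      Cj : C j ≡ false
      Cj = not-injective ¬Cj
      Aj : A j ≡ false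
      Aj = ¬-not λ Aj → contradiction (trans (≡-sym (A⊆C j Aj)) Cj) λ ()

    k≤∣∁C∣ : ∀ {v} → C v ≡ false → k ≤ count (∁ᵇ C)
    k≤∣∁C∣ {v} Cv = s≤s⁻¹ (s≤s⁻¹ (begin-strict
      suc k                        ≤⟨ δ v ⟩
      count (adj G v)              ≡⟨ degree-split G C v ⟩
      deg G C v + deg G (∁ᵇ C) v   ≤⟨ +-monoˡ-≤ (deg G (∁ᵇ C) v) (degC≤2 Cv) ⟩
      2 + deg G (∁ᵇ C) v           <⟨ +-monoʳ-< 2 (deg-< G {X = ∁ᵇ C} (cong not Cv)) ⟩
      2 + count (∁ᵇ C)             ∎))
      where open ≤-Reasoning

    B-b⊆∁C : ∀ {v} → C v ≡ false → B -ᵇ b ⊆ᵇ ∁ᵇ C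
    B-b⊆∁C Cv = count-⊆-≤⇒⊇ ∁C⊆B-b
      (≤-trans (s≤s⁻¹ (subst (_≤ suc k) (count-remove B (cong not Ab)) ∣∁A∣≤k+1)) (k≤∣∁C∣ Cv))

    deg-B-b≤2 : B -ᵇ b ⊆ᵇ ∁ᵇ C → deg G B b ≤ 2
    deg-B-b≤2 B-b⊆∁C = slack≤2 (λ j → 𝟙 (adj G b j ∧ B j))
      (λ j Aj → subst (λ a → deg G A j + 𝟙 a ≤ 2)
        (≡-sym (trans (cong (λ a → adj G b j ∧ not a) Aj) (∧-identityʳ _))) (tight j Aj))
      (λ j Aj → cong 𝟙 (trans (cong (λ a → adj G b j ∧ not a) Aj) (∧-zeroʳ _)))
      where
      tight : ∀ j → A j ≡ false → deg G A j + 𝟙 (adj G b j) ≤ 2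
      tight j Aj with j ≟ b
      ... | yes refl = subst (λ a → deg G A j + 𝟙 a ≤ 2) (≡-sym (irref G j))
                         (subst (_≤ 2) (≡-sym (+-identityʳ _)) (s≤s⁻¹ (A-stable j Aj)))
      ... | no j≢b = ≤-trans (subst (λ a → deg G A j + 𝟙 a ≤ deg G C j) (sym G j b) (deg+𝟙adj≤deg G j A⊆C Ab Cb))
                       (degC≤2 (not-injective (B-b⊆∁C j (-ᵇ-intro {P = B} (cong not Aj) j≢b))))

    C-full : ∀ v → C v ≡ true
    C-full v = ¬-not λ Cv → contradiction (suc-k≤4 Cv) (<⇒≱ (≤-trans (n≤1+n 5) (≤-trans 6≤k (n≤1+n k))))
      where
      open ≤-Reasoning
      suc-k≤4 : C v ≡ false → suc k ≤ 4
      suc-k≤4 Cv = begin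
        suc k                  ≤⟨ δ b ⟩
        count (adj G b)        ≡⟨ degree-split G A b ⟩
        deg G A b + deg G B b  ≤⟨ +-mono-≤ (s≤s⁻¹ (A-stable b Ab)) (deg-B-b≤2 (B-b⊆∁C Cv)) ⟩
        4                      ∎

  three-percolating : ∃ λ S → ∣ S ∣ ≡ 3 × Percolates G 3 S
  three-percolating
    with p , Ap ← 1≤count⇒member {P = A} (subst (1 ≤_) (≡-sym ∣A∣≡k) (≤-trans (s≤s z≤n) 6≤k))
    with b , p~b∧Bb ← 1≤count⇒member {P = adj G p ∩ᵇ B} (≤-trans (s≤s z≤n) (2≤deg-B Ap))
    with x , y , x≢y , p~x∧Ax , p~y∧Ay ← 2≤count⇒pair {P = adj G p ∩ᵇ A} (2≤deg-A Ap)
    = S , ∣S∣≡3 , λ v → t , lookup⇒[]= v C (C-full v)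
    where
    p~b : adj G p b ≡ true
    p~b = proj₁ (∧-true⁻ p~b∧Bb)
    Ab : A b ≡ false
    Ab = not-injective (proj₂ (∧-true⁻ {adj G p b} p~b∧Bb))
    p~x : adj G p x ≡ true
    p~x = proj₁ (∧-true⁻ p~x∧Ax)
    Ax : A x ≡ true
    Ax = proj₂ (∧-true⁻ {adj G p x} p~x∧Ax)
    p~y : adj G p y ≡ true
    p~y = proj₁ (∧-true⁻ p~y∧Ay)
    Ay : A y ≡ true
    Ay = proj₂ (∧-true⁻ {adj G p y} p~y∧Ay)
    S : Subset n
    S = tabulate ⁅ x , y , b ⁆ᵇ
    ∣S∣≡3 : ∣ S ∣ ≡ 3
    ∣S∣≡3 = trans (∣p∣≡count S) (trans (sum-cong-≗ (cong 𝟙 ∘ lookup∘tabulate ⁅ x , y , b ⁆ᵇ))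
      (count-⁅x,y,z⁆ᵇ x≢y (≢-by A Ax Ab) (≢-by A Ay Ab)))
    stabilises : ∃ λ t → Stable G 3 (iter G 3 S t)
    stabilises = iter-stabilises G 3 S
    t : ℕ
    t = proj₁ stabilises
    C : Subset n
    C = iter G 3 S t
    S⊆C : ∀ i → ⁅ x , y , b ⁆ᵇ i ≡ true → lookup C i ≡ true
    S⊆C i Si = []=⇒lookup (⊆-iter G 3 S t (lookup⇒[]= i S (trans (lookup∘tabulate ⁅ x , y , b ⁆ᵇ i) Si)))
    open Closure (lookup C) (Stable⇒Stableᵇ {G = G} (proj₂ stabilises)) Ap Ab Ax Ay p~b p~x p~y x≢y
      (S⊆C x (x∈⁅x,y,z⁆ᵇ x y b)) (S⊆C y (y∈⁅x,y,z⁆ᵇ x y b)) (S⊆C b (z∈⁅x,y,z⁆ᵇ x y b))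

n≤[n/2]+suc[n/2] : ∀ n → n ≤ n / 2 + suc (n / 2)
n≤[n/2]+suc[n/2] n = begin
  n                    ≡⟨ m≡m%n+[m/n]*n n 2 ⟩
  n % 2 + n / 2 * 2    ≤⟨ +-monoˡ-≤ (n / 2 * 2) (s≤s⁻¹ (m%n<n n 2)) ⟩
  suc (n / 2 * 2)      ≡⟨ cong suc (trans (*-comm (n / 2) 2) (cong (n / 2 +_) (+-identityʳ (n / 2)))) ⟩
  suc (n / 2 + n / 2)  ≡⟨ +-suc (n / 2) (n / 2) ⟨
  n / 2 + suc (n / 2)  ∎
  where open ≤-Reasoning

proposition4p2 : (n : ℕ) → 13 ≤ n → (G : Graph n) → δ≥ G (n / 2 + 1)
    → (A : Subset n) → ∣ A ∣ ≡ n / 2 → Closed G 3 A → m≡ G 3 3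
proposition4p2 n 13≤n G δ A ∣A∣≡n/2 closed =
  ClosedHalf.three-percolating G (lookup A) (n / 2) (/-monoˡ-≤ 2 13≤n) degree≥ ∣A∣≡k ∣∁A∣≤k+1
    (Stable⇒Stableᵇ {G = G} (closed⇒stable closed))
  , λ _ → percolating⇒r≤∣A∣ (≤-trans (s≤s (s≤s (s≤s z≤n))) 13≤n)
  where
  k : ℕ
  k = n / 2
  degree≥ : ∀ v → suc k ≤ count (adj G v)
  degree≥ v = subst₂ _≤_ (+-comm k 1) (∣N∣≡degree G v) (δ v)
  ∣A∣≡k : count (lookup A) ≡ k
  ∣A∣≡k = trans (≡-sym (∣p∣≡count A)) ∣A∣≡n/2
  ∣∁A∣≤k+1 : count (∁ᵇ (lookup A)) ≤ suc k
  ∣∁A∣≤k+1 = +-cancelˡ-≤ k _ _ (subst (_≤ k + suc k)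
    (trans (≡-sym (count+count∁ (lookup A))) (cong (_+ count (∁ᵇ (lookup A))) ∣A∣≡k)) (n≤[n/2]+suc[n/2] n))
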